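{- Let $L$ be a finite partial lattice with $n$ elements, and let $B_1,\dots,B_m$ (principal blocks, with headers $h_1,\dots,h_m$) and $B_{\mathrm{res}}$ (residual block) be a block decomposition of $L$ with block size $k=\sqrt n$. For each $x\in L$ let $\mathrm{DOWN}(x) = \{z \in L : z \le x\} \cap B_x$, where $B_x$ is the block containing $x$. Consider the following procedure which, given $x,y \in L$, answers whether $x \le y$: (1) if $x \in B_i$ for a principal block $B_i$, compute $y_i = h_i \land y$ (the meet in $L$, possibly nonexistent); if $y_i$ exists and $y_i \in B_i$, answer "yes" iff $x \in \mathrm{DOWN}(y_i)$, and otherwise answer "no"; (2) if $x, y \in B_{\mathrm{res}}$, answer "yes" iff $x \in \mathrm{DOWN}(y)$; (3) if $x \in B_{\mathrm{res}}$ and $y \notin B_{\mathrm{res}}$, answer "no". This procedure answers correctly for every pair $x,y\in L$.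
   Context: A partial lattice is a partially ordered set in which, whenever $x_1,x_2<y_1,y_2$, there exists $z$ with $x_1,x_2\le z\le y_1,y_2$; equivalently, two elements with a common lower (upper) bound have a unique meet $\land$ (join $\lor$). All meets and downsets are taken in $L$. Block decomposition with block size $k$: call $x$ fat (relative to the current poset) if it has at least $k$ elements below or equal to it, thin otherwise; while there is a fat element $h$ all of whose strictly smaller elements are thin (a minimal fat element), make $\{z \le h\}$ (within the current poset) a new principal block with block header $h$ and delete it; when no fat element remains, the remaining elements form the residual block $B_{\mathrm{res}}$. -}

module Defs where

open import Data.Nat using (ℕ; zero; suc; _*_) renaming (_≤_ to _≤ℕ_)
open import Data.Fin using (Fin)
open import Data.Fin.Subset using (Subset; _∈_; _∉_; _∩_; ∁; ∣_∣; ⊤)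
open import Data.Vec using (Vec; []; _∷_; tabulate; lookup)
open import Data.Product using (Σ; ∃; _×_; _,_)
open import Data.Sum using (_⊎_)
open import Relation.Nullary using (¬_; does)
open import Relation.Binary.Core using (Rel)
open import Relation.Binary.Definitions using (Decidable)
open import Relation.Binary.Structures using (IsPartialOrder)
open import Relation.Binary.PropositionalEquality using (_≡_; _≢_)

record FinPartialLattice (n : ℕ) : Set₁ where
  field
    _≤_            : Rel (Fin n) _
    isPartialOrder : IsPartialOrder _≡_ _≤_
    _≤?_           : Decidable _≤_

  _<_ : Rel (Fin n) _
  x < y = x ≤ y × x ≢ y

  field
    partial : ∀ x₁ x₂ y₁ y₂ → x₁ < y₁ → x₁ < y₂ → x₂ < y₁ → x₂ < y₂ →
              ∃ λ z → x₁ ≤ z × x₂ ≤ z × z ≤ y₁ × z ≤ y₂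

  IsMeet : Fin n → Fin n → Fin n → Set
  IsMeet a b m = m ≤ a × m ≤ b × (∀ z → z ≤ a → z ≤ b → z ≤ m)

  DownIn : Subset n → Fin n → Subset n
  DownIn S h = S ∩ tabulate (λ z → does (z ≤? h))

  _－_ : Subset n → Subset n → Subset n
  S － D = S ∩ ∁ D

  -- fat relative to the current poset S, block size k = √n:
  -- at least √n elements of S below or equal to x, i.e. (count)² ≥ n
  Fat : Subset n → Fin n → Set
  Fat S x = x ∈ S × n ≤ℕ ∣ DownIn S x ∣ * ∣ DownIn S x ∣

  MinimalFat : Subset n → Fin n → Set
  MinimalFat S h = Fat S h × (∀ z → z ∈ S → z < h → ¬ Fat S z)

  blocks : ∀ {m} → Subset n → Vec (Fin n) m → Vec (Subset n) m
  blocks S []       = []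
  blocks S (h ∷ hs) = DownIn S h ∷ blocks (S － DownIn S h) hs

  residual : ∀ {m} → Subset n → Vec (Fin n) m → Subset n
  residual S []       = S
  residual S (h ∷ hs) = residual (S － DownIn S h) hs

  data ValidRun : ∀ {m} → Subset n → Vec (Fin n) m → Set where
    done : ∀ {S} → (∀ x → ¬ Fat S x) → ValidRun S []
    step : ∀ {m S h} {hs : Vec (Fin n) m} →
           MinimalFat S h → ValidRun (S － DownIn S h) hs → ValidRun S (h ∷ hs)

  BlockDecomposition : ∀ {m} → Vec (Fin n) m → Set
  BlockDecomposition hs = ValidRun ⊤ hs

  module Decomp {m} (hs : Vec (Fin n) m) where
    header : Fin m → Fin n
    header i = lookup hs i

    B : Fin m → Subset n
    B i = lookup (blocks ⊤ hs) i

    Bres : Subset n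
    Bres = residual ⊤ hs

    SameBlock : Fin n → Fin n → Set
    SameBlock x z = (∃ λ i → x ∈ B i × z ∈ B i) ⊎ (x ∈ Bres × z ∈ Bres)

    _∈DOWN_ : Fin n → Fin n → Set
    x ∈DOWN z = x ≤ z × SameBlock x z

module Submission where

-- Deleting the down-set {z ∈ S : z ≤ h} from an up-closed
--     set S leaves an up-closed set.  Starting from the whole of L, every
--     intermediate poset of the decomposition is therefore up-closed; so is
--     the residual block, and each principal block B_i is the down-set of its
--     header h_i inside an up-closed set S'.  (Neither fact needs the headers
--     to be minimal fat elements: any sequence of headers will do.)
--
-- If h and y have a common lower bound x, then their meet exists
--     and lies above x: the common lower bounds are directed (by the partial
--     lattice axiom), and a finite directed set has a greatest element.
--
-- For x ∈ B_i with x ≤ y, the meet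
-- y_i = h_i ∧ y exists and lies above x, hence in S' (up-closure) and below
-- h_i, i.e. in B_i.  For x in the residual block, anything above x is again
-- residual, which yields cases (2) and (3).

open import Defs
open import Data.Nat using (ℕ)
open import Data.Fin using (Fin; zero; suc)
open import Data.Fin.Subset using (Subset; _∈_; _∉_; ⊤; inside)
open import Data.Fin.Subset.Properties using (x∈p∩q⁺; x∈p∩q⁻; x∈∁p⇒x∉p; x∉p⇒x∈∁p; ∈⊤)
open import Data.Vec using (Vec; []; _∷_; lookup; tabulate)
open import Data.Vec.Properties using ([]=⇒lookup; lookup⇒[]=; lookup∘tabulate)
open import Data.List using (List; []; _∷_; allFin)
open import Data.List.Relation.Unary.All using (All; []; _∷_) renaming (lookup to lookupAll)
open import Data.List.Membership.Propositional.Properties using (∈-allFin)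
open import Data.Empty using (⊥-elim)
open import Data.Product using (∃; _×_; _,_; proj₁; proj₂)
open import Data.Sum using (inj₁; inj₂)
open import Relation.Nullary using (¬_; Dec; yes; no; does; proof)
open import Relation.Nullary.Decidable using (dec-true; _×-dec_)
open import Relation.Nullary.Reflects using (Reflects; invert)
open import Relation.Binary.Structures using (IsPartialOrder)
open import Relation.Binary.PropositionalEquality using (_≡_; refl; sym; trans; subst)
open import Function.Bundles using (_⇔_; mk⇔)

module PartialLatticeFacts {n : ℕ} (L : FinPartialLattice n) where
  open FinPartialLattice L
  module PO = IsPartialOrder isPartialOrder

  ∈DownIn⁺ : ∀ {S h x} → x ∈ S → x ≤ h → x ∈ DownIn S h
  ∈DownIn⁺ {h = h} {x} x∈S x≤h =
    x∈p∩q⁺ (x∈S , lookup⇒[]= x _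
      (trans (lookup∘tabulate (λ z → does (z ≤? h)) x) (dec-true (x ≤? h) x≤h)))

  ∈DownIn⁻ : ∀ {S h x} → x ∈ DownIn S h → x ∈ S × x ≤ h
  ∈DownIn⁻ {S} {h} {x} x∈D with x∈p∩q⁻ S _ x∈D
  ... | x∈S , x∈T = x∈S , invert (subst (Reflects (x ≤ h)) does≡inside (proof (x ≤? h)))
    where
    does≡inside : does (x ≤? h) ≡ inside
    does≡inside = trans (sym (lookup∘tabulate (λ z → does (z ≤? h)) x)) ([]=⇒lookup x∈T)

  UpClosed : Subset n → Set
  UpClosed S = ∀ {a b} → a ≤ b → a ∈ S → b ∈ S

  ⊤-upClosed : UpClosed ⊤
  ⊤-upClosed _ _ = ∈⊤

  -- Deleting a down-set from an up-closed set keeps it up-closed: if a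
  -- survived and a ≤ b, then b cannot lie below h, or a would too.
  delete-upClosed : ∀ {S} h → UpClosed S → UpClosed (S － DownIn S h)
  delete-upClosed {S} h up {a} {b} a≤b a∈ with x∈p∩q⁻ S _ a∈
  ... | a∈S , a∉D = x∈p∩q⁺ (b∈S , x∉p⇒x∈∁p b∉D)
    where
    b∈S : b ∈ S
    b∈S = up a≤b a∈S
    b∉D : b ∉ DownIn S h
    b∉D b∈D = x∈∁p⇒x∉p a∉D (∈DownIn⁺ a∈S (PO.trans a≤b (proj₂ (∈DownIn⁻ b∈D))))

  residual-upClosed : ∀ {m S} (hs : Vec (Fin n) m) → UpClosed S → UpClosed (residual S hs)
  residual-upClosed []       up = up
  residual-upClosed (h ∷ hs) up = residual-upClosed hs (delete-upClosed h up)

  block-isDownIn : ∀ {m S} (hs : Vec (Fin n) m) → UpClosed S → (i : Fin m) →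
                   ∃ λ S′ → UpClosed S′ × lookup (blocks S hs) i ≡ DownIn S′ (lookup hs i)
  block-isDownIn {S = S} (h ∷ hs) up zero    = S , up , refl
  block-isDownIn         (h ∷ hs) up (suc i) = block-isDownIn hs (delete-upClosed h up) i

  LowerBound : Fin n → Fin n → Fin n → Set
  LowerBound h y z = z ≤ h × z ≤ y

  lowerBound? : ∀ h y z → Dec (LowerBound h y z)
  lowerBound? h y z = (z ≤? h) ×-dec (z ≤? y)

  strictlyBelow : ∀ {h y a} → ¬ h ≤ y → a ≤ h → a ≤ y → a < h
  strictlyBelow h≰y a≤h a≤y = a≤h , λ a≡h → h≰y (subst (_≤ _) a≡h a≤y)

  -- The common lower bounds of h and y are directed.  If h and y are
  -- comparable the smaller one is an upper bound; otherwise the partial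
  -- lattice axiom applies to a, b < h, y.
  lowerBounds-directed : ∀ {h y a b} → LowerBound h y a → LowerBound h y b →
                         ∃ λ d → LowerBound h y d × a ≤ d × b ≤ d
  lowerBounds-directed {h} {y} (a≤h , a≤y) (b≤h , b≤y) with h ≤? y | y ≤? h
  ... | yes h≤y | _       = h , (PO.refl , h≤y) , a≤h , b≤h
  ... | no _    | yes y≤h = y , (y≤h , PO.refl) , a≤y , b≤y
  ... | no h≰y  | no y≰h with partial _ _ h y
        (strictlyBelow h≰y a≤h a≤y) (strictlyBelow y≰h a≤y a≤h)
        (strictlyBelow h≰y b≤h b≤y) (strictlyBelow y≰h b≤y b≤h)
  ... | d , a≤d , b≤d , d≤h , d≤y = d , (d≤h , d≤y) , a≤d , b≤d

  dominateList : ∀ {h y c} → LowerBound h y c → (zs : List (Fin n)) →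
                 ∃ λ m → LowerBound h y m × c ≤ m ×
                         All (λ z → LowerBound h y z → z ≤ m) zs
  dominateList {c = c} c-lb [] = c , c-lb , PO.refl , []
  dominateList {h} {y} c-lb (z ∷ zs) with lowerBound? h y z
  ... | no ¬z-lb with dominateList c-lb zs
  ...   | m , m-lb , c≤m , below = m , m-lb , c≤m , (λ z-lb → ⊥-elim (¬z-lb z-lb)) ∷ below
  dominateList c-lb (z ∷ zs) | yes z-lb with lowerBounds-directed c-lb z-lb
  ... | d , d-lb , c≤d , z≤d with dominateList d-lb zs
  ...   | m , m-lb , d≤m , below = m , m-lb , PO.trans c≤d d≤m , (λ _ → PO.trans z≤d d≤m) ∷ below

  -- Meets exist for elements with a common lower bound x, and lie above x:
  -- dominate all elements of the (finite) lattice.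
  meet-exists : ∀ {h y x} → LowerBound h y x → ∃ λ m → IsMeet h y m × x ≤ m
  meet-exists x-lb with dominateList x-lb (allFin n)
  ... | m , (m≤h , m≤y) , x≤m , below =
    m , (m≤h , m≤y , λ z z≤h z≤y → lookupAll below (∈-allFin z) (z≤h , z≤y)) , x≤m

-- The three cases of the query, for the blocks cut out by any sequence of
-- headers hs.
module BlockQuery {n : ℕ} (L : FinPartialLattice n) {m : ℕ} (hs : Vec (Fin n) m) where
  open FinPartialLattice L
  open Decomp hs
  open PartialLatticeFacts L

  principal-query : ∀ {x y} (i : Fin m) → x ∈ B i →
    x ≤ y ⇔ (∃ λ yᵢ → IsMeet (header i) y yᵢ × yᵢ ∈ B i × x ∈DOWN yᵢ)
  principal-query {x} {y} i x∈Bᵢ with block-isDownIn hs ⊤-upClosed i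
  ... | S′ , up , Bᵢ≡ = mk⇔ meetWitness (λ (_ , (_ , yᵢ≤y , _) , _ , x≤yᵢ , _) → PO.trans x≤yᵢ yᵢ≤y)
    where
    meetWitness : x ≤ y → ∃ λ yᵢ → IsMeet (header i) y yᵢ × yᵢ ∈ B i × x ∈DOWN yᵢ
    meetWitness x≤y with ∈DownIn⁻ (subst (x ∈_) Bᵢ≡ x∈Bᵢ)
    ... | x∈S′ , x≤hᵢ with meet-exists (x≤hᵢ , x≤y)
    ... | yᵢ , isMeet@(yᵢ≤hᵢ , _ , _) , x≤yᵢ = yᵢ , isMeet , yᵢ∈Bᵢ , x≤yᵢ , inj₁ (i , x∈Bᵢ , yᵢ∈Bᵢ)
      where
      -- yᵢ is above x ∈ S′, so in S′ by up-closure, and below hᵢ.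
      yᵢ∈Bᵢ : yᵢ ∈ B i
      yᵢ∈Bᵢ = subst (yᵢ ∈_) (sym Bᵢ≡) (∈DownIn⁺ (up x≤yᵢ x∈S′) yᵢ≤hᵢ)

  residual-query : ∀ {x y} → x ∈ Bres → y ∈ Bres → x ≤ y ⇔ x ∈DOWN y
  residual-query x∈R y∈R = mk⇔ (λ x≤y → x≤y , inj₂ (x∈R , y∈R)) proj₁

  residual-escape : ∀ {x y} → x ∈ Bres → y ∉ Bres → ¬ x ≤ y
  residual-escape x∈R y∉R x≤y = y∉R (residual-upClosed hs ⊤-upClosed x≤y x∈R)

proposition6 : (n : ℕ) (L : FinPartialLattice n) (m : ℕ) (hs : Vec (Fin n) m) →
    FinPartialLattice.BlockDecomposition L hs →
    let open FinPartialLattice L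
        open Decomp hs
    in (x y : Fin n) →
       ((i : Fin m) → x ∈ B i →
          (x ≤ y ⇔ (∃ λ yᵢ → IsMeet (header i) y yᵢ × yᵢ ∈ B i × x ∈DOWN yᵢ)))
       × (x ∈ Bres → y ∈ Bres → (x ≤ y ⇔ x ∈DOWN y))
       × (x ∈ Bres → y ∉ Bres → ¬ (x ≤ y))
proposition6 n L m hs _ x y = principal-query , residual-query , residual-escape
  where open BlockQuery L hs
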